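{- Let $P=P(G,[\omega])$ be a toric poset over a finite simple graph $G=(V,E)$, and let $i,j\in V$ be such that the toric interval $I=[i,j]^{\mathrm{tor}}$ has $|I|\ge 3$. Then $$[i,j]^{\mathrm{tor}}=\{i,j\}\cup\{k\in V: [w|_{\{i,j,k\}}]=[(i,k,j)] \text{ for all } [w]\in\mathcal{L}_{\mathrm{tor}}(P)\}.$$
   Context: $G$ has vertex set $V$, $|V|=n$; $\omega$ is an acyclic orientation of $G$, toric equivalence is generated by converting sources into sinks, and the toric chamber $c(P)\subseteq\mathbb{R}^V/\mathbb{Z}^V$ is the set of points $x$ (coordinates represented in $[0,1)$) with $x_a\neq x_b$ for all $\{a,b\}\in E$ and whose orientation (edge $a\to b$ iff $x_a<x_b$) is toric equivalent to $\omega$. A cyclic class $[(i_1,\dots,i_m)]$ is the set of cyclic shifts of the sequence. A subset $C=\{i_1,\dots,i_m\}$ is a toric chain of $P$ if there is a cyclic class $[(i_1,\dots,i_m)]$ such that for every $x\in c(P)$ some $(j_1,\dots,j_m)$ in that class has $0\le x_{j_1}<\dots<x_{j_m}<1$; then write $P|_C=[(i_1,\dots,i_m)]$. The toric interval $[i,j]^{\mathrm{tor}}$ is: $\{i\}$ if $i=j$; $\varnothing$ if $i,j$ lie on no common toric chain; otherwise $\{i,j\}\cup\{k\in V: \{i,j,k\}\text{ is a toric chain with } P|_{\{i,j,k\}}=[(i,k,j)]\}$. For a permutation $w=(w_1,\dots,w_n)$ of $V$, its cyclic class $[w]$ determines the total toric order whose chamber is $c_{[w]}=\{x: 0\le x_{w'_1}<\dots<x_{w'_n}<1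 \text{ for some } w'\in[w]\}$. $\mathcal{L}_{\mathrm{tor}}(P)$, the set of total toric extensions of $P$, is the set of $[w]$ with $c_{[w]}\subseteq c(P)$. For $C\subseteq V$, $[w|_C]$ is the cyclic class of the subsequence of $w$ consisting of the elements of $C$.
   Formalization: Points of the toric chambers $c(P)$ and $c_{[w]}$ are taken in ℚ^V with coordinates in [0,1) rather than in $\mathbb{R}^V/\mathbb{Z}^V$. -}

module Defs where

open import Data.Nat using (ℕ)
open import Data.Fin using (Fin; _≟_)
open import Data.Bool using (Bool; true; false; _∧_; _∨_; if_then_else_)
open import Data.List using (List; []; _∷_; _++_; drop; take; map; filter; allFin)
open import Data.List.Membership.Propositional using (_∈_)
open import Data.List.Relation.Unary.Unique.Propositional using (Unique)
open import Data.List.Relation.Unary.Linked using (Linked)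
open import Data.List.Relation.Binary.Permutation.Propositional using (_↭_)
open import Data.Rational using (ℚ; 0ℚ; 1ℚ; _<_; _≤_)
open import Data.Rational.Properties using (_<?_)
open import Data.Product using (Σ; ∃; ∃-syntax; _×_)
open import Data.Sum using (_⊎_)
open import Relation.Nullary using (¬_)
open import Relation.Nullary.Decidable using (⌊_⌋; _⊎-dec_)
open import Relation.Binary.PropositionalEquality using (_≡_; _≢_)
open import Relation.Binary.Construct.Closure.Equivalence using (EqClosure)
open import Relation.Binary.Construct.Closure.Transitive using (TransClosure)

record SimpleGraph (n : ℕ) : Set where
  field
    adj    : Fin n → Fin n → Bool
    sym    : ∀ a b → adj a b ≡ adj b a
    irrefl : ∀ a → adj a a ≡ false
open SimpleGraph public

-- A (partial) orientation candidate: ω a b ≡ true means edge a → b.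
Orient : ℕ → Set
Orient n = Fin n → Fin n → Bool

IsOrientation : ∀ {n} → SimpleGraph n → Orient n → Set
IsOrientation {n} G ω =
  (∀ (a b : Fin n) → ω a b ≡ true → adj G a b ≡ true) ×
  (∀ (a b : Fin n) → adj G a b ≡ true →
     (ω a b ≡ true × ω b a ≡ false) ⊎ (ω a b ≡ false × ω b a ≡ true))

IsAcyclic : ∀ {n} → Orient n → Set
IsAcyclic {n} ω = ∀ (a : Fin n) → ¬ TransClosure (λ u v → ω u v ≡ true) a a

IsAcyclicOrientation : ∀ {n} → SimpleGraph n → Orient n → Set
IsAcyclicOrientation G ω = IsOrientation G ω × IsAcyclic ω

IsSource : ∀ {n} → SimpleGraph n → Orient n → Fin n → Set
IsSource G ω v = ∀ u → adj G v u ≡ true → ω v u ≡ true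

flipAt : ∀ {n} → Fin n → Orient n → Orient n
flipAt v ω a b = if (⌊ a ≟ v ⌋ ∨ ⌊ b ≟ v ⌋) then ω b a else ω a b

SourceToSink : ∀ {n} → SimpleGraph n → Orient n → Orient n → Set
SourceToSink G ω ω' = ∃[ v ] (IsSource G ω v × (∀ a b → ω' a b ≡ flipAt v ω a b))

ToricEquiv : ∀ {n} → SimpleGraph n → Orient n → Orient n → Set
ToricEquiv {n} G ω ω' =
  ∃[ ω'' ] (EqClosure (SourceToSink G) ω ω'' × (∀ a b → ω'' a b ≡ ω' a b))

-- points of [0,1)^V (representatives of R^V/Z^V), with rational coordinates
Point : ℕ → Set
Point n = Fin n → ℚ

InUnitBox : ∀ {n} → Point n → Set
InUnitBox x = ∀ v → (0ℚ ≤ x v) × (x v < 1ℚ)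

orientOf : ∀ {n} → SimpleGraph n → Point n → Orient n
orientOf G x a b = adj G a b ∧ ⌊ x a <? x b ⌋

InChamber : ∀ {n} → SimpleGraph n → Orient n → Point n → Set
InChamber G ω x =
  InUnitBox x ×
  (∀ a b → adj G a b ≡ true → x a ≢ x b) ×
  ToricEquiv G (orientOf G x) ω

rotate : ∀ {A : Set} → ℕ → List A → List A
rotate k l = drop k l ++ take k l

SameCyclicClass : ∀ {A : Set} → List A → List A → Set
SameCyclicClass l l' = ∃[ k ] (rotate k l ≡ l')

CyclicallyIncreasing : ∀ {n} → Point n → List (Fin n) → Set
CyclicallyIncreasing x s = ∃[ k ] Linked _<_ (map x (rotate k s))

-- the set of entries of the (duplicate-free) sequence s is a toric chain
-- of P with P|_C = [s]
IsToricChainSeq : ∀ {n} → SimpleGraph n → Orient n → List (Fin n) → Set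
IsToricChainSeq G ω s =
  Unique s × (∀ x → InChamber G ω x → CyclicallyIncreasing x s)

OnCommonToricChain : ∀ {n} → SimpleGraph n → Orient n → Fin n → Fin n → Set
OnCommonToricChain G ω i j =
  ∃[ s ] (IsToricChainSeq G ω s × i ∈ s × j ∈ s)

InToricInterval : ∀ {n} → SimpleGraph n → Orient n → Fin n → Fin n → Fin n → Set
InToricInterval G ω i j k =
  (i ≡ j × k ≡ i) ⊎
  (i ≢ j × OnCommonToricChain G ω i j ×
    (k ≡ i ⊎ k ≡ j ⊎ IsToricChainSeq G ω (i ∷ k ∷ j ∷ [])))

IntervalAtLeast3 : ∀ {n} → SimpleGraph n → Orient n → Fin n → Fin n → Set
IntervalAtLeast3 G ω i j =
  ∃[ a ] ∃[ b ] ∃[ c ]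
    (InToricInterval G ω i j a × InToricInterval G ω i j b ×
     InToricInterval G ω i j c × a ≢ b × a ≢ c × b ≢ c)

IsPermutation : ∀ {n} → List (Fin n) → Set
IsPermutation {n} w = w ↭ allFin n

InChamberOfTotal : ∀ {n} → List (Fin n) → Point n → Set
InChamberOfTotal w x = InUnitBox x × CyclicallyIncreasing x w

IsTotalToricExtension : ∀ {n} → SimpleGraph n → Orient n → List (Fin n) → Set
IsTotalToricExtension G ω w =
  IsPermutation w × (∀ x → InChamberOfTotal w x → InChamber G ω x)

restrict3 : ∀ {n} → Fin n → Fin n → Fin n → List (Fin n) → List (Fin n)
restrict3 i j k = filter (λ v → (v ≟ i) ⊎-dec ((v ≟ j) ⊎-dec (v ≟ k)))

-- For a total toric extension [w], the point that places the vertices at 0, 1/(n+1), 2/(n+1), ...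
-- in the order of w lies in c_[w] ⊆ c(P); if {i,k,j} is a toric chain with P|_{i,k,j} = [(i,k,j)],
-- this point orders i, k, j cyclically as (i,k,j), hence so does w.
-- Conversely, let x ∈ c(P) and let w list the vertices by increasing x-coordinate, ties broken by
-- a total order on V. Then [w] ∈ L_tor(P): a point of c_[w] induces the orientation of the linear
-- order given by some rotation of w; moving the first vertex of a linear order to the end converts
-- a source into a sink; and x induces the orientation of w itself. So w restricts to [(i,k,j)].
-- Doing this once with increasing and once with decreasing tie-breaks rules out ties among
-- x_i, x_k, x_j, so x is strictly cyclically increasing along (i,k,j).

module Submission where

open import Defs renaming (sym to adj-sym)
open import Data.Nat using (ℕ)
open import Data.Fin using (Fin)
open import Data.List using (List; []; _∷_)
open import Data.Product using (_×_)
open import Data.Sum using (_⊎_)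
open import Function.Bundles using (_⇔_; mk⇔)
open import Relation.Binary.PropositionalEquality using (_≡_)

open import Data.Bool using (true; false; _∧_; _∨_; if_then_else_)
open import Data.Bool.Properties using (∧-zeroʳ)
open import Data.Empty using (⊥; ⊥-elim)
open import Data.Fin using (_≟_)
open import Data.Integer using (+_)
open import Data.List using (_++_; drop; take; map; allFin; length)
open import Data.List.Membership.Propositional using (_∈_; _∉_)
open import Data.List.Relation.Binary.Permutation.Propositional
  using (_↭_; ↭⇒↭ₛ; ↭-sym; ↭-trans; ↭-reflexive)
open import Data.List.Relation.Unary.All as All using (All; []; _∷_)
open import Data.List.Relation.Unary.AllPairs as AllPairs using (AllPairs; []; _∷_)
open import Data.List.Relation.Unary.Any using (here; there)
open import Data.List.Relation.Unary.Linked as Linked using (Linked; []; [-]; _∷_)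
open import Data.List.Relation.Unary.Unique.Propositional using (Unique)
open import Data.Nat using (suc; zero; _<_; _≤_; z≤n; s≤s; _<?_; _<ᵇ_)
open import Data.Product using (∃-syntax; _,_; proj₁; proj₂)
open import Data.Rational using (0ℚ; 1ℚ)
open import Data.Sum using (inj₁; inj₂)
open import Level using (0ℓ)
open import Relation.Binary.Bundles using (DecTotalOrder)
open import Relation.Binary.Construct.Closure.Equivalence using (EqClosure)
open import Relation.Binary.Construct.Closure.ReflexiveTransitive using (ε; _◅_; _◅◅_)
open import Relation.Binary.Construct.Closure.Symmetric using (fwd; bwd)
open import Relation.Binary.Definitions using (tri<; tri≈; tri>)
open import Relation.Binary.PropositionalEquality
  using (module ≡-Reasoning; _≢_; refl; sym; trans; cong; cong₂; subst; subst₂; setoid)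
open import Relation.Binary.Structures using (IsDecTotalOrder)
open import Relation.Nullary using (¬_; yes; no)
open import Relation.Nullary.Decidable using (⌊_⌋; _⊎-dec_; Dec; isYes≗does; dec-true; dec-false)

import Data.Fin.Properties as Fin
import Data.Integer as ℤ
import Data.Integer.Properties as ℤ
import Data.List.Membership.Propositional.Properties as ∈
import Data.List.Properties as List
import Data.List.Relation.Binary.Permutation.Propositional.Properties as ↭
import Data.List.Relation.Binary.Permutation.Setoid.Properties as ↭ₛ
import Data.List.Relation.Unary.AllPairs.Properties as AllPairs
import Data.List.Relation.Unary.Linked.Properties as Linked
import Data.List.Relation.Unary.Unique.Propositional.Properties as Unique
import Data.List.Sort as Sort
import Data.Nat.Properties as ℕ
import Data.Product.Relation.Binary.Lex.NonStrict as Lex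
import Data.Rational as ℚ
import Data.Rational.Properties as ℚ
import Data.Rational.Unnormalised as ℚᵘ
import Data.Rational.Unnormalised.Properties as ℚᵘ
import Relation.Binary.Construct.Flip.EqAndOrd as Flip
import Relation.Binary.Construct.On as On

private
  variable
    A : Set
    n : ℕ

⌊⌋-true : (a? : Dec A) → A → ⌊ a? ⌋ ≡ true
⌊⌋-true a? a = trans (isYes≗does a?) (dec-true a? a)

⌊⌋-false : (a? : Dec A) → ¬ A → ⌊ a? ⌋ ≡ false
⌊⌋-false a? ¬a = trans (isYes≗does a?) (dec-false a? ¬a)

≤∧≢⇒< : ∀ {p q : ℚ.ℚ} → p ℚ.≤ q → p ≢ q → p ℚ.< q
≤∧≢⇒< p≤q p≢q = ℚ.≰⇒> (λ q≤p → p≢q (ℚ.≤-antisym p≤q q≤p))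

≤⇒≯ : ∀ {p q : ℚ.ℚ} → p ℚ.≤ q → ¬ q ℚ.< p
≤⇒≯ p≤q q<p = ℚ.<-irrefl refl (ℚ.<-≤-trans q<p p≤q)

position : Fin n → List (Fin n) → ℕ
position a []      = 0
position a (b ∷ u) with a ≟ b
... | yes _ = 0
... | no  _ = suc (position a u)

position-head : ∀ (a : Fin n) u → position a (a ∷ u) ≡ 0
position-head a u with a ≟ a
... | yes _   = refl
... | no  a≢a = ⊥-elim (a≢a refl)

position-tail : ∀ {a b : Fin n} u → a ≢ b → position a (b ∷ u) ≡ suc (position a u)
position-tail {a = a} {b} u a≢b with a ≟ b
... | yes a≡b = ⊥-elim (a≢b a≡b)
... | no  _   = refl

∈-tail : ∀ {a b : A} {u} → a ∈ b ∷ u → a ≢ b → a ∈ u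
∈-tail (here a≡b) a≢b = ⊥-elim (a≢b a≡b)
∈-tail (there a∈u) _  = a∈u

position-≤-length : ∀ (a : Fin n) u → position a u ≤ length u
position-≤-length a []      = z≤n
position-≤-length a (b ∷ u) with a ≟ b
... | yes _ = z≤n
... | no  _ = s≤s (position-≤-length a u)

position-<-length : ∀ {a : Fin n} {u} → a ∈ u → position a u < length u
position-<-length {a = a} {b ∷ u} a∈ with a ≟ b
... | yes _   = s≤s z≤n
... | no  a≢b = s≤s (position-<-length (∈-tail a∈ a≢b))

position-injective : ∀ {a b : Fin n} {u} → a ∈ u → b ∈ u → position a u ≡ position b u → a ≡ b
position-injective {a = a} {b} {c ∷ u} a∈ b∈ eq with a ≟ c | b ≟ c
... | yes a≡c | yes b≡c = trans a≡c (sym b≡c)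
... | yes _   | no  _   = ⊥-elim (ℕ.0≢1+n eq)
... | no  _   | yes _   = ⊥-elim (ℕ.0≢1+n (sym eq))
... | no  a≢c | no  b≢c = position-injective (∈-tail a∈ a≢c) (∈-tail b∈ b≢c) (ℕ.suc-injective eq)

position-++ˡ : ∀ {a : Fin n} {u} v → a ∈ u → position a (u ++ v) ≡ position a u
position-++ˡ {a = a} {c ∷ u} v a∈ with a ≟ c
... | yes _   = refl
... | no  a≢c = cong suc (position-++ˡ v (∈-tail a∈ a≢c))

position-∉-++ : ∀ {a : Fin n} u v → a ∉ u → position a (u ++ a ∷ v) ≡ length u
position-∉-++ {a = a} []      v _   = position-head a v
position-∉-++ {a = a} (c ∷ u) v a∉ with a ≟ c
... | yes a≡c = ⊥-elim (a∉ (here a≡c))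
... | no  _   = cong suc (position-∉-++ u v (λ a∈u → a∉ (there a∈u)))

AllPairs-position : ∀ {R : Fin n → Fin n → Set} {a b : Fin n} {u} → AllPairs R u →
                    a ∈ u → b ∈ u → position a u < position b u → R a b
AllPairs-position {a = a} {b} {c ∷ u} (Rc ∷ Ru) a∈ b∈ lt with a ≟ c | b ≟ c
... | _        | yes _   = ⊥-elim (ℕ.n≮0 lt)
... | yes refl | no  b≢c = All.lookup Rc (∈-tail b∈ b≢c)
... | no  a≢c  | no  b≢c = AllPairs-position Ru (∈-tail a∈ a≢c) (∈-tail b∈ b≢c) (ℕ.≤-pred lt)

AllPairs-connex : ∀ {R : Fin n → Fin n → Set} {u} → (∀ q → q ∈ u) → AllPairs R u →
                  ∀ {a b} → a ≢ b → R a b ⊎ R b a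
AllPairs-connex {u = u} u-complete Ru {a} {b} a≢b with ℕ.<-cmp (position a u) (position b u)
... | tri< lt _ _ = inj₁ (AllPairs-position Ru (u-complete a) (u-complete b) lt)
... | tri≈ _ eq _ = ⊥-elim (a≢b (position-injective (u-complete a) (u-complete b) eq))
... | tri> _ _ gt = inj₂ (AllPairs-position Ru (u-complete b) (u-complete a) gt)

Linked-mapWithAll : ∀ {P : A → Set} {R S : A → A → Set} {u} →
  (∀ {a b} → P a → P b → R a b → S a b) → All P u → Linked R u → Linked S u
Linked-mapWithAll f []              []       = []
Linked-mapWithAll f (_ ∷ [])        [-]      = [-]
Linked-mapWithAll f (Pa ∷ Pb ∷ Pu) (r ∷ rs) = f Pa Pb r ∷ Linked-mapWithAll f (Pb ∷ Pu) rs

position-increasing : ∀ {u : List (Fin n)} → Unique u → Linked (λ a b → position a u < position b u) u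
position-increasing {u = []}        _ = []
position-increasing {u = c ∷ []}    _ = [-]
position-increasing {u = c ∷ d ∷ t} ((c≢d ∷ c∉t) ∷ u!) =
  head< ∷ Linked-mapWithAll shift (≢c (c≢d ∷ c∉t)) (position-increasing u!)
  where
  ≢c : ∀ {v} → All (c ≢_) v → All (_≢ c) v
  ≢c = All.map (λ c≢a a≡c → c≢a (sym a≡c))
  head< : position c (c ∷ d ∷ t) < position d (c ∷ d ∷ t)
  head< rewrite position-head c (d ∷ t) | position-tail (d ∷ t) (λ d≡c → c≢d (sym d≡c)) = s≤s z≤n
  shift : ∀ {a b} → a ≢ c → b ≢ c → position a (d ∷ t) < position b (d ∷ t) →
          position a (c ∷ d ∷ t) < position b (c ∷ d ∷ t)
  shift a≢c b≢c lt rewrite position-tail (d ∷ t) a≢c | position-tail (d ∷ t) b≢c = s≤s lt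

AllPairs-≡ : ∀ {R : A → A → Set} → (∀ {a} → ¬ R a a) → (∀ {a b} → R a b → ¬ R b a) →
  ∀ {u v} → AllPairs R u → AllPairs R v →
  (∀ {a} → a ∈ u → a ∈ v) → (∀ {a} → a ∈ v → a ∈ u) → u ≡ v
AllPairs-≡ irr asym [] [] _ _ = refl
AllPairs-≡ irr asym [] (_ ∷ _) _ v⊆u with v⊆u (here refl)
... | ()
AllPairs-≡ irr asym (_ ∷ _) [] u⊆v _ with u⊆v (here refl)
... | ()
AllPairs-≡ {R = R} irr asym {a ∷ u} {b ∷ v} (Ra ∷ Ru) (Rb ∷ Rv) u⊆v v⊆u =
  cong₂ _∷_ a≡b (AllPairs-≡ irr asym Ru Rv tail⊆ tail⊇)
  where
  a≡b : a ≡ b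
  a≡b with u⊆v (here refl) | v⊆u (here refl)
  ... | here a≡b   | _          = a≡b
  ... | there _    | here b≡a   = sym b≡a
  ... | there a∈v  | there b∈u  = ⊥-elim (asym (All.lookup Ra b∈u) (All.lookup Rb a∈v))
  tail⊆ : ∀ {c} → c ∈ u → c ∈ v
  tail⊆ c∈u with u⊆v (there c∈u)
  ... | there c∈v = c∈v
  ... | here refl = ⊥-elim (irr (subst (R a) (sym a≡b) (All.lookup Ra c∈u)))
  tail⊇ : ∀ {c} → c ∈ v → c ∈ u
  tail⊇ c∈v with v⊆u (there c∈v)
  ... | there c∈u = c∈u
  ... | here refl = ⊥-elim (irr (subst (R b) a≡b (All.lookup Rb c∈v)))

IsPermutation⇒Unique : ∀ {u : List (Fin n)} → IsPermutation u → Unique u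
IsPermutation⇒Unique {n = n} u↭ = ↭ₛ.Unique-resp-↭ (setoid _) (↭⇒↭ₛ (↭-sym u↭)) (Unique.allFin⁺ n)

IsPermutation⇒∈ : ∀ {u : List (Fin n)} → IsPermutation u → ∀ a → a ∈ u
IsPermutation⇒∈ u↭ a = ↭.∈-resp-↭ (↭-sym u↭) (∈.∈-allFin a)

rotate-↭ : ∀ r (u : List A) → rotate r u ↭ u
rotate-↭ r u = ↭-trans (↭.++-comm (drop r u) (take r u)) (↭-reflexive (List.take++drop≡id r u))

IsPermutation-rotate : ∀ r {u : List (Fin n)} → IsPermutation u → IsPermutation (rotate r u)
IsPermutation-rotate r {u} u↭ = ↭-trans (rotate-↭ r u) u↭

rotateOnce : List A → List A
rotateOnce []      = []
rotateOnce (a ∷ u) = u ++ a ∷ []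

drop-suc-∷ : ∀ r (u : List A) {a v} → drop r u ≡ a ∷ v →
             drop (suc r) u ≡ v × take (suc r) u ≡ take r u ++ a ∷ []
drop-suc-∷ zero    (b ∷ u) refl = refl , refl
drop-suc-∷ (suc r) (b ∷ u) eq   with drop-suc-∷ r u eq
... | drop≡ , take≡ = drop≡ , cong (b ∷_) take≡

drop-suc-[] : ∀ r (u : List A) → drop r u ≡ [] → drop (suc r) u ≡ [] × take (suc r) u ≡ take r u
drop-suc-[] zero    []      _  = refl , refl
drop-suc-[] (suc r) []      _  = refl , refl
drop-suc-[] (suc r) (b ∷ u) eq with drop-suc-[] r u eq
... | drop≡ , take≡ = drop≡ , cong (b ∷_) take≡

-- The first case occurs once r ≥ length u.
rotate-suc : ∀ r (u : List A) → rotate (suc r) u ≡ rotate r u ⊎ rotate (suc r) u ≡ rotateOnce (rotate r u)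
rotate-suc r u with drop r u in eq
... | [] with drop-suc-[] r u eq
...   | drop≡ , take≡ rewrite drop≡ | take≡ = inj₁ refl
rotate-suc r u | a ∷ v with drop-suc-∷ r u eq
...   | drop≡ , take≡ rewrite drop≡ | take≡ = inj₂ (sym (List.++-assoc v (take r u) (a ∷ [])))

rotate-3 : ∀ r (a b c : A) → SameCyclicClass (rotate r (a ∷ b ∷ c ∷ [])) (a ∷ b ∷ c ∷ [])
rotate-3 0                   a b c = 0 , refl
rotate-3 1                   a b c = 2 , refl
rotate-3 2                   a b c = 1 , refl
rotate-3 3                   a b c = 0 , refl
rotate-3 (suc (suc (suc (suc r)))) a b c = 0 , refl

SameCyclicClass-3 : ∀ {s} (a b c : A) → SameCyclicClass s (a ∷ b ∷ c ∷ []) →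
  s ≡ a ∷ b ∷ c ∷ [] ⊎ s ≡ c ∷ a ∷ b ∷ [] ⊎ s ≡ b ∷ c ∷ a ∷ []
-- The length equation makes every other shape of s absurd.
SameCyclicClass-3 {s = s} a b c (r , eq) with trans (sym (cong length eq)) (↭.↭-length (rotate-↭ r s))
SameCyclicClass-3 {s = _ ∷ _ ∷ _ ∷ []} a b c (0                   , refl) | _ = inj₁ refl
SameCyclicClass-3 {s = _ ∷ _ ∷ _ ∷ []} a b c (1                   , refl) | _ = inj₂ (inj₁ refl)
SameCyclicClass-3 {s = _ ∷ _ ∷ _ ∷ []} a b c (2                   , refl) | _ = inj₂ (inj₂ refl)
SameCyclicClass-3 {s = _ ∷ _ ∷ _ ∷ []} a b c (3                   , refl) | _ = inj₁ refl
SameCyclicClass-3 {s = _ ∷ _ ∷ _ ∷ []} a b c (suc (suc (suc (suc _))) , refl) | _ = inj₁ refl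

-- Toric equivalence

infix 4 _≐_
_≐_ : Orient n → Orient n → Set
f ≐ g = ∀ a b → f a b ≡ g a b

≐-sym : {f g : Orient n} → f ≐ g → g ≐ f
≐-sym f≐g a b = sym (f≐g a b)

≐-trans : {f g h : Orient n} → f ≐ g → g ≐ h → f ≐ h
≐-trans f≐g g≐h a b = trans (f≐g a b) (g≐h a b)

flipAt-cong : ∀ (v : Fin n) {f g} → f ≐ g → flipAt v f ≐ flipAt v g
flipAt-cong v f≐g a b = cong₂ (λ x y → if ⌊ a ≟ v ⌋ ∨ ⌊ b ≟ v ⌋ then x else y) (f≐g b a) (f≐g a b)

module _ (G : SimpleGraph n) where

  open ≡-Reasoning

  private
    S = SourceToSink G

  EqClosure-respˡ : ∀ {f f' g} → EqClosure S f g → f' ≐ f → ∃[ g' ] (EqClosure S f' g' × g' ≐ g)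
  EqClosure-respˡ {f' = f'} ε f'≐f = f' , ε , f'≐f
  EqClosure-respˡ {f' = f'} (fwd (v , src , h≐) ◅ rest) f'≐f
    with EqClosure-respˡ rest (≐-trans (flipAt-cong v f'≐f) (≐-sym h≐))
  ... | g' , path , g'≐g =
    g' , fwd (v , (λ u e → trans (f'≐f v u) (src u e)) , (λ _ _ → refl)) ◅ path , g'≐g
  EqClosure-respˡ (bwd (v , src , f≐) ◅ rest) f'≐f with EqClosure-respˡ rest (λ _ _ → refl)
  ... | g' , path , g'≐g = g' , bwd (v , src , ≐-trans f'≐f f≐) ◅ path , g'≐g

  toricEquiv-reflexive : {f g : Orient n} → f ≐ g → ToricEquiv G f g
  toricEquiv-reflexive {f} f≐g = f , ε , f≐g

  toricEquiv-trans : {f g h : Orient n} → ToricEquiv G f g → ToricEquiv G g h → ToricEquiv G f h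
  toricEquiv-trans (f' , f~f' , f'≐g) (g' , g~g' , g'≐h) with EqClosure-respˡ g~g' f'≐g
  ... | h' , f'~h' , h'≐g' = h' , f~f' ◅◅ f'~h' , ≐-trans h'≐g' g'≐h

  -- Orientations induced by linear orders

  linearOrient : List (Fin n) → Orient n
  linearOrient u a b = adj G a b ∧ (position a u <ᵇ position b u)

  adj⇒≢ : ∀ {a b} → adj G a b ≡ true → a ≢ b
  adj⇒≢ {a} e refl with trans (sym e) (irrefl G a)
  ... | ()

  linearOrient-head-source : ∀ a m → IsSource G (linearOrient (a ∷ m)) a
  linearOrient-head-source a m b e
    rewrite e | position-head a m | position-tail m (λ b≡a → adj⇒≢ e (sym b≡a)) = refl

  linearOrient-positions : ∀ u {p q s t} → position p u ≡ s → position q u ≡ t →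
                           linearOrient u p q ≡ adj G p q ∧ (s <ᵇ t)
  linearOrient-positions u refl refl = refl

  linearOrient-rotateOnce-flip : ∀ {a m} → a ∉ m → (∀ {q} → q ≢ a → q ∈ m) →
    linearOrient (m ++ a ∷ []) ≐ flipAt a (linearOrient (a ∷ m))
  linearOrient-rotateOnce-flip {a} {m} a∉m m-complete p q with p ≟ a | q ≟ a
  ... | yes refl | yes refl =
    cong (adj G p p ∧_) (dec-false (position p (m ++ p ∷ []) <? position p (m ++ p ∷ [])) (ℕ.<-irrefl refl))
  ... | yes refl | no q≢a = begin
    linearOrient (m ++ p ∷ []) p q
      ≡⟨ linearOrient-positions (m ++ p ∷ []) (position-∉-++ m [] a∉m) (position-++ˡ (p ∷ []) q∈m) ⟩
    adj G p q ∧ (length m <ᵇ position q m)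
      ≡⟨ cong (adj G p q ∧_) (dec-false (length m <? position q m) (ℕ.<-asym (position-<-length q∈m))) ⟩
    adj G p q ∧ false
      ≡⟨ trans (∧-zeroʳ _) (sym (∧-zeroʳ _)) ⟩
    adj G q p ∧ false ∎
    where q∈m = m-complete q≢a
  ... | no p≢a | yes refl = begin
    linearOrient (m ++ q ∷ []) p q
      ≡⟨ linearOrient-positions (m ++ q ∷ []) (position-++ˡ (q ∷ []) p∈m) (position-∉-++ m [] a∉m) ⟩
    adj G p q ∧ (position p m <ᵇ length m)
      ≡⟨ cong (adj G p q ∧_) (dec-true (position p m <? length m) (position-<-length p∈m)) ⟩
    adj G p q ∧ true
      ≡⟨ cong (_∧ true) (adj-sym G p q) ⟩
    adj G q p ∧ true ∎
    where p∈m = m-complete p≢a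
  ... | no p≢a | no q≢a = begin
    linearOrient (m ++ a ∷ []) p q
      ≡⟨ linearOrient-positions (m ++ a ∷ [])
           (position-++ˡ (a ∷ []) (m-complete p≢a)) (position-++ˡ (a ∷ []) (m-complete q≢a)) ⟩
    adj G p q ∧ (position p m <ᵇ position q m) ∎

  linearOrient-rotateOnce : ∀ {u} → IsPermutation u → ToricEquiv G (linearOrient (rotateOnce u)) (linearOrient u)
  linearOrient-rotateOnce {u = []}    _  = toricEquiv-reflexive (λ _ _ → refl)
  linearOrient-rotateOnce {u = a ∷ m} u↭ =
    linearOrient (a ∷ m) ,
    bwd (a , linearOrient-head-source a m , linearOrient-rotateOnce-flip a∉m m-complete) ◅ ε ,
    (λ _ _ → refl)
    where
    a∉m : a ∉ m
    a∉m a∈m with IsPermutation⇒Unique u↭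
    ... | a≢m ∷ _ = All.lookup a≢m a∈m refl
    m-complete : ∀ {q} → q ≢ a → q ∈ m
    m-complete {q} q≢a = ∈-tail (IsPermutation⇒∈ u↭ q) q≢a

  linearOrient-rotate : ∀ r {u} → IsPermutation u → ToricEquiv G (linearOrient (rotate r u)) (linearOrient u)
  linearOrient-rotate zero    {u} _ =
    toricEquiv-reflexive (λ a b → cong (λ v → linearOrient v a b) (List.++-identityʳ u))
  linearOrient-rotate (suc r) {u} u↭ with rotate-suc r u
  ... | inj₁ eq rewrite eq = linearOrient-rotate r u↭
  ... | inj₂ eq rewrite eq =
    toricEquiv-trans (linearOrient-rotateOnce (IsPermutation-rotate r u↭)) (linearOrient-rotate r u↭)

  Separates : Point n → Set
  Separates x = ∀ a b → adj G a b ≡ true → x a ≢ x b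

  orientOf-sorted : ∀ {x : Point n} {u} → (∀ q → q ∈ u) → AllPairs (λ a b → x a ℚ.≤ x b) u →
    Separates x → orientOf G x ≐ linearOrient u
  orientOf-sorted {x = x} {u} u-complete x↗ x-sep a b with adj G a b in e
  ... | false = refl
  ... | true with ℕ.<-cmp (position a u) (position b u)
  ... | tri< lt _ _ = trans
    (⌊⌋-true (x a ℚ.<? x b) (≤∧≢⇒< (AllPairs-position x↗ (u-complete a) (u-complete b) lt) (x-sep a b e)))
    (sym (dec-true (position a u <? position b u) lt))
  ... | tri≈ _ eq _ = ⊥-elim (adj⇒≢ e (position-injective (u-complete a) (u-complete b) eq))
  ... | tri> _ _ gt = trans
    (⌊⌋-false (x a ℚ.<? x b) (≤⇒≯ (AllPairs-position x↗ (u-complete b) (u-complete a) gt)))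
    (sym (dec-false (position a u <? position b u) (ℕ.<-asym gt)))

  increasing⇒separates : ∀ {y : Point n} {u} → (∀ q → q ∈ u) →
                         AllPairs (λ a b → y a ℚ.< y b) u → Separates y
  increasing⇒separates u-complete y↗ a b e with AllPairs-connex u-complete y↗ (adj⇒≢ e)
  ... | inj₁ ya<yb = ℚ.<⇒≢ ya<yb
  ... | inj₂ yb<ya = λ ya≡yb → ℚ.<⇒≢ yb<ya (sym ya≡yb)

  toricEquiv-sorted-rotate : ∀ {x y : Point n} {w} r → IsPermutation w →
    AllPairs (λ a b → x a ℚ.≤ x b) w → Separates x →
    AllPairs (λ a b → y a ℚ.≤ y b) (rotate r w) → Separates y →
    ToricEquiv G (orientOf G y) (orientOf G x)
  toricEquiv-sorted-rotate r w↭ x↗ x-sep y↗ y-sep =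
    toricEquiv-trans
      (toricEquiv-reflexive (orientOf-sorted (IsPermutation⇒∈ (IsPermutation-rotate r w↭)) y↗ y-sep))
   (toricEquiv-trans (linearOrient-rotate r w↭)
                     (toricEquiv-reflexive (≐-sym (orientOf-sorted (IsPermutation⇒∈ w↭) x↗ x-sep))))

  isTotalToricExtension-sorted : ∀ {ω} {x : Point n} {w} → InChamber G ω x → IsPermutation w →
    AllPairs (λ a b → x a ℚ.≤ x b) w → IsTotalToricExtension G ω w
  isTotalToricExtension-sorted {ω} {x} {w} (_ , x-sep , x~ω) w↭ x↗ = w↭ , c[w]⊆c[P]
    where
    c[w]⊆c[P] : ∀ y → InChamberOfTotal w y → InChamber G ω y
    c[w]⊆c[P] y (y∈box , r , y↗) =
      y∈box , y-sep ,
      toricEquiv-trans (toricEquiv-sorted-rotate r w↭ x↗ x-sep (AllPairs.map ℚ.<⇒≤ y<) y-sep) x~ω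
      where
      y< : AllPairs (λ a b → y a ℚ.< y b) (rotate r w)
      y< = Linked.Linked⇒AllPairs ℚ.<-trans (Linked.map⁻ y↗)
      y-sep : Separates y
      y-sep = increasing⇒separates (IsPermutation⇒∈ (IsPermutation-rotate r w↭)) y<

-- A point of the chamber of a total toric order

-- fraction d m is m / (1 + d), since mkℚᵘ stores the denominator minus one.
fraction : ℕ → ℕ → ℚ.ℚ
fraction d m = ℚ.fromℚᵘ (ℚᵘ.mkℚᵘ (+ m) d)

fromℚᵘ-mono-< : ∀ {p q} → p ℚᵘ.< q → ℚ.fromℚᵘ p ℚ.< ℚ.fromℚᵘ q
fromℚᵘ-mono-< {p} {q} p<q = ℚ.toℚᵘ-cancel-<
  (ℚᵘ.<-respˡ-≃ (ℚᵘ.≃-sym (ℚ.toℚᵘ-fromℚᵘ p))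
    (ℚᵘ.<-respʳ-≃ (ℚᵘ.≃-sym (ℚ.toℚᵘ-fromℚᵘ q)) p<q))

fromℚᵘ-mono-≤ : ∀ {p q} → p ℚᵘ.≤ q → ℚ.fromℚᵘ p ℚ.≤ ℚ.fromℚᵘ q
fromℚᵘ-mono-≤ {p} {q} p≤q = ℚ.toℚᵘ-cancel-≤
  (ℚᵘ.≤-respˡ-≃ (ℚᵘ.≃-sym (ℚ.toℚᵘ-fromℚᵘ p))
    (ℚᵘ.≤-respʳ-≃ (ℚᵘ.≃-sym (ℚ.toℚᵘ-fromℚᵘ q)) p≤q))

fraction-mono-< : ∀ d {m m'} → m < m' → fraction d m ℚ.< fraction d m'
fraction-mono-< d {m} {m'} m<m' = fromℚᵘ-mono-< {ℚᵘ.mkℚᵘ (+ m) d} {ℚᵘ.mkℚᵘ (+ m') d} (ℚᵘ.*<*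
  (subst₂ ℤ._<_ (ℤ.pos-* m (suc d)) (ℤ.pos-* m' (suc d)) (ℤ.+<+ (ℕ.*-monoˡ-< (suc d) m<m'))))

fraction-nonNeg : ∀ d m → 0ℚ ℚ.≤ fraction d m
fraction-nonNeg d m = fromℚᵘ-mono-≤ {ℚᵘ.0ℚᵘ} {ℚᵘ.mkℚᵘ (+ m) d}
  (ℚᵘ.*≤* (subst (ℤ._≤_ (+ 0)) (ℤ.pos-* m 1) (ℤ.+≤+ z≤n)))

fraction-<1 : ∀ {d m} → m ≤ d → fraction d m ℚ.< 1ℚ
fraction-<1 {d} {m} m≤d = fromℚᵘ-mono-< {ℚᵘ.mkℚᵘ (+ m) d} {ℚᵘ.1ℚᵘ}
  (ℚᵘ.*<* (subst₂ ℤ._<_ (ℤ.pos-* m 1) (ℤ.pos-* 1 (suc d))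
    (ℤ.+<+ (subst₂ _<_ (sym (ℕ.*-identityʳ m)) (sym (ℕ.*-identityˡ (suc d))) (s≤s m≤d)))))

positionPoint : List (Fin n) → Point n
positionPoint u v = fraction (length u) (position v u)

positionPoint-increasing : ∀ {u : List (Fin n)} → Unique u →
                           Linked (λ a b → positionPoint u a ℚ.< positionPoint u b) u
positionPoint-increasing {u = u} u! = Linked.map (fraction-mono-< (length u)) (position-increasing u!)

positionPoint-inChamberOfTotal : ∀ {u : List (Fin n)} → Unique u → InChamberOfTotal u (positionPoint u)
positionPoint-inChamberOfTotal {u = u} u! =
  (λ v → fraction-nonNeg (length u) (position v u) , fraction-<1 (position-≤-length v u)) ,
  0 , subst (λ v → Linked ℚ._<_ (map (positionPoint u) v)) (sym (List.++-identityʳ u))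
            (Linked.map⁺ (positionPoint-increasing u!))

-- Restrictions to three vertices

∈-[ikj]⇒ : ∀ {i j k v : Fin n} → v ∈ i ∷ k ∷ j ∷ [] → v ≡ i ⊎ v ≡ j ⊎ v ≡ k
∈-[ikj]⇒ (here v≡i)                 = inj₁ v≡i
∈-[ikj]⇒ (there (here v≡k))         = inj₂ (inj₂ v≡k)
∈-[ikj]⇒ (there (there (here v≡j))) = inj₂ (inj₁ v≡j)

⇒∈-[ikj] : ∀ {i j k v : Fin n} → v ≡ i ⊎ v ≡ j ⊎ v ≡ k → v ∈ i ∷ k ∷ j ∷ []
⇒∈-[ikj] (inj₁ v≡i)        = here v≡i
⇒∈-[ikj] (inj₂ (inj₁ v≡j)) = there (there (here v≡j))
⇒∈-[ikj] (inj₂ (inj₂ v≡k)) = there (here v≡k)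

∈ijk? : (i j k v : Fin n) → Dec (v ≡ i ⊎ v ≡ j ⊎ v ≡ k)
∈ijk? i j k v = (v ≟ i) ⊎-dec ((v ≟ j) ⊎-dec (v ≟ k))

restrict3-⊆ : ∀ {i j k v : Fin n} w → v ∈ restrict3 i j k w → v ∈ i ∷ k ∷ j ∷ []
restrict3-⊆ {i = i} {j} {k} w v∈ = ⇒∈-[ikj] (proj₂ (∈.∈-filter⁻ (∈ijk? i j k) {xs = w} v∈))

restrict3-⊇ : ∀ {i j k v : Fin n} w → v ∈ w → v ∈ i ∷ k ∷ j ∷ [] → v ∈ restrict3 i j k w
restrict3-⊇ {i = i} {j} {k} w v∈w v∈ikj = ∈.∈-filter⁺ (∈ijk? i j k) v∈w (∈-[ikj]⇒ v∈ikj)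

AllPairs-restrict3 : ∀ {R : Fin n → Fin n → Set} (i j k : Fin n) {w} →
                     AllPairs R w → AllPairs R (restrict3 i j k w)
AllPairs-restrict3 i j k = AllPairs.filter⁺ (∈ijk? i j k)

AllExtensionsRestrictTo : SimpleGraph n → Orient n → Fin n → Fin n → Fin n → Set
AllExtensionsRestrictTo {n} G ω i j k =
  ∀ (w : List (Fin n)) → IsTotalToricExtension G ω w → SameCyclicClass (restrict3 i j k w) (i ∷ k ∷ j ∷ [])

toricChain⇒restrict3 : ∀ (G : SimpleGraph n) {ω} (i j k : Fin n) →
  IsToricChainSeq G ω (i ∷ k ∷ j ∷ []) → AllExtensionsRestrictTo G ω i j k
toricChain⇒restrict3 G i j k (_ , chain) w (w↭ , c[w]⊆c[P]) =
  subst (λ s → SameCyclicClass s ikj) (sym restrict≡rotate) (rotate-3 r i k j)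
  where
  ikj = i ∷ k ∷ j ∷ []
  w! = IsPermutation⇒Unique w↭
  y  = positionPoint w
  y↗ : CyclicallyIncreasing y ikj
  y↗ = chain y (c[w]⊆c[P] y (positionPoint-inChamberOfTotal w!))
  r  = proj₁ y↗
  restrict≡rotate : restrict3 i j k w ≡ rotate r ikj
  restrict≡rotate = AllPairs-≡ (ℚ.<-irrefl refl) ℚ.<-asym
    (AllPairs-restrict3 i j k (Linked.Linked⇒AllPairs ℚ.<-trans (positionPoint-increasing w!)))
    (Linked.Linked⇒AllPairs ℚ.<-trans (Linked.map⁻ (proj₂ y↗)))
    (λ v∈ → ↭.∈-resp-↭ (↭-sym (rotate-↭ r ikj)) (restrict3-⊆ w v∈))
    (λ {v} v∈ → restrict3-⊇ w (IsPermutation⇒∈ w↭ v) (↭.∈-resp-↭ (rotate-↭ r ikj) v∈))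

CyclicallyOrdered : (A → A → Set) → A → A → A → Set
CyclicallyOrdered R a b c = (R a b × R b c) ⊎ (R b c × R c a) ⊎ (R c a × R a b)

restrict3-cyclicallyOrdered : ∀ {R : Fin n → Fin n → Set} (i j k : Fin n) {w} → AllPairs R w →
  SameCyclicClass (restrict3 i j k w) (i ∷ k ∷ j ∷ []) → CyclicallyOrdered R i k j
restrict3-cyclicallyOrdered {R = R} i j k {w} Rw restrict~ikj
  with restrict3 i j k w | AllPairs-restrict3 i j k Rw | SameCyclicClass-3 i k j restrict~ikj
... | _ | (Rik ∷ _ ∷ []) ∷ (Rkj ∷ []) ∷ [] ∷ [] | inj₁ refl        = inj₁ (Rik , Rkj)
... | _ | (Rji ∷ _ ∷ []) ∷ (Rik ∷ []) ∷ [] ∷ [] | inj₂ (inj₁ refl) = inj₂ (inj₂ (Rji , Rik))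
... | _ | (Rkj ∷ _ ∷ []) ∷ (Rji ∷ []) ∷ [] ∷ [] | inj₂ (inj₂ refl) = inj₂ (inj₁ (Rkj , Rji))

cyclicallyIncreasing-from-tieBreaks :
  ∀ {x : Point n} {R S : Fin n → Fin n → Set} →
  (∀ {a b} → R a b → x a ℚ.≤ x b) → (∀ {a b} → S a b → x a ℚ.≤ x b) →
  (∀ {a b} → a ≢ b → R a b → S a b → x a ℚ.< x b) →
  ∀ {a b c} → a ≢ b → b ≢ c → c ≢ a →
  CyclicallyOrdered R a b c → CyclicallyOrdered S a b c → CyclicallyIncreasing x (a ∷ b ∷ c ∷ [])
cyclicallyIncreasing-from-tieBreaks {x = x} R≤ S≤ RS< {a} {b} {c} a≢b b≢c c≢a = combine
  where
  cycle : ∀ {p q r} → x p ℚ.< x q → x q ℚ.≤ x r → x r ℚ.≤ x p → ⊥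
  cycle p<q q≤r r≤p = ℚ.<-irrefl refl (ℚ.<-≤-trans p<q (ℚ.≤-trans q≤r r≤p))
  combine : CyclicallyOrdered _ a b c → CyclicallyOrdered _ a b c → CyclicallyIncreasing x (a ∷ b ∷ c ∷ [])
  combine (inj₁ (ab , bc))        (inj₁ (ab' , bc'))        = 0 , RS< a≢b ab ab' ∷ RS< b≢c bc bc' ∷ [-]
  combine (inj₁ (ab , bc))        (inj₂ (inj₁ (bc' , ca)))  = ⊥-elim (cycle (RS< b≢c bc bc') (S≤ ca) (R≤ ab))
  combine (inj₁ (ab , bc))        (inj₂ (inj₂ (ca , ab')))  = ⊥-elim (cycle (RS< a≢b ab ab') (R≤ bc) (S≤ ca))
  combine (inj₂ (inj₁ (bc , ca))) (inj₁ (ab , bc'))         = ⊥-elim (cycle (RS< b≢c bc bc') (R≤ ca) (S≤ ab))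
  combine (inj₂ (inj₁ (bc , ca))) (inj₂ (inj₁ (bc' , ca'))) = 1 , RS< b≢c bc bc' ∷ RS< c≢a ca ca' ∷ [-]
  combine (inj₂ (inj₁ (bc , ca))) (inj₂ (inj₂ (ca' , ab)))  = ⊥-elim (cycle (RS< c≢a ca ca') (S≤ ab) (R≤ bc))
  combine (inj₂ (inj₂ (ca , ab))) (inj₁ (ab' , bc))         = ⊥-elim (cycle (RS< a≢b ab ab') (S≤ bc) (R≤ ca))
  combine (inj₂ (inj₂ (ca , ab))) (inj₂ (inj₁ (bc , ca')))  = ⊥-elim (cycle (RS< c≢a ca ca') (R≤ ab) (S≤ bc))
  combine (inj₂ (inj₂ (ca , ab))) (inj₂ (inj₂ (ca' , ab'))) = 2 , RS< c≢a ca ca' ∷ RS< a≢b ab ab' ∷ [-]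

module TieBreak (x : Point n) {_⊑_ : Fin n → Fin n → Set} (⊑-isDecTotalOrder : IsDecTotalOrder _≡_ _⊑_) where

  order : DecTotalOrder 0ℓ 0ℓ 0ℓ
  order = On.decTotalOrder
    (Lex.×-decTotalOrder ℚ.≤-decTotalOrder (record { isDecTotalOrder = ⊑-isDecTotalOrder }))
    (λ a → x a , a)

  open DecTotalOrder order public using () renaming (_≤_ to _≼_)
  open Sort order using (sort; sort-↭; sort-↗)

  ≼⇒≤ : ∀ {a b} → a ≼ b → x a ℚ.≤ x b
  ≼⇒≤ (inj₁ (xa≤xb , _)) = xa≤xb
  ≼⇒≤ (inj₂ (xa≡xb , _)) = ℚ.≤-reflexive xa≡xb

  sorted : List (Fin n)
  sorted = sort (allFin n)

  sorted-↗ : AllPairs _≼_ sorted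
  sorted-↗ = Linked.Linked⇒AllPairs (DecTotalOrder.trans order) (sort-↗ (allFin n))

  sorted-isTotalToricExtension : ∀ G {ω} → InChamber G ω x → IsTotalToricExtension G ω sorted
  sorted-isTotalToricExtension G x∈c =
    isTotalToricExtension-sorted G x∈c (sort-↭ (allFin n)) (AllPairs.map ≼⇒≤ sorted-↗)

restrict3⇒toricChain : ∀ (G : SimpleGraph n) {ω} (i j k : Fin n) → i ≢ j → k ≢ i → k ≢ j →
  AllExtensionsRestrictTo G ω i j k → IsToricChainSeq G ω (i ∷ k ∷ j ∷ [])
restrict3⇒toricChain G {ω} i j k i≢j k≢i k≢j restrict~ikj =
  ((i≢k ∷ i≢j ∷ []) ∷ (k≢j ∷ []) ∷ [] ∷ []) , cyclic
  where
  i≢k : i ≢ k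
  i≢k i≡k = k≢i (sym i≡k)
  j≢i : j ≢ i
  j≢i j≡i = i≢j (sym j≡i)
  cyclic : ∀ x → InChamber G ω x → CyclicallyIncreasing x (i ∷ k ∷ j ∷ [])
  cyclic x x∈c = cyclicallyIncreasing-from-tieBreaks ↑.≼⇒≤ ↓.≼⇒≤ ↑∩↓⇒< i≢k k≢j j≢i
    (restrict3-cyclicallyOrdered i j k ↑.sorted-↗ (restrict~ikj ↑.sorted (↑.sorted-isTotalToricExtension G x∈c)))
    (restrict3-cyclicallyOrdered i j k ↓.sorted-↗ (restrict~ikj ↓.sorted (↓.sorted-isTotalToricExtension G x∈c)))
    where
    module ↑ = TieBreak x Fin.≤-isDecTotalOrder
    module ↓ = TieBreak x (Flip.isDecTotalOrder Fin.≤-isDecTotalOrder)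
    ↑∩↓⇒< : ∀ {a b} → a ≢ b → a ↑.≼ b → a ↓.≼ b → x a ℚ.< x b
    ↑∩↓⇒< _   (inj₁ (xa≤xb , xa≢xb)) _                     = ≤∧≢⇒< xa≤xb xa≢xb
    ↑∩↓⇒< _   (inj₂ (xa≡xb , _))     (inj₁ (_ , xa≢xb))    = ⊥-elim (xa≢xb xa≡xb)
    ↑∩↓⇒< a≢b (inj₂ (_ , a≤b))       (inj₂ (_ , b≤a))      = ⊥-elim (a≢b (Fin.≤-antisym a≤b b≤a))

intervalAtLeast3⇒onCommonToricChain : ∀ (G : SimpleGraph n) ω {i j} → IntervalAtLeast3 G ω i j →
  i ≢ j × OnCommonToricChain G ω i j
intervalAtLeast3⇒onCommonToricChain _ _ (_ , _ , _ , inj₂ (i≢j , chain , _) , _)                  = i≢j , chain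
intervalAtLeast3⇒onCommonToricChain _ _ (_ , _ , _ , inj₁ _ , inj₂ (i≢j , chain , _) , _)         = i≢j , chain
intervalAtLeast3⇒onCommonToricChain _ _ (_ , _ , _ , inj₁ (_ , a≡i) , inj₁ (_ , b≡i) , _ , a≢b , _) =
  ⊥-elim (a≢b (trans a≡i (sym b≡i)))

corollary5p12 : ∀ {n : ℕ} (G : SimpleGraph n) (ω : Orient n) →
    IsAcyclicOrientation G ω →
    (i j : Fin n) → IntervalAtLeast3 G ω i j →
    (k : Fin n) →
      InToricInterval G ω i j k ⇔
      (k ≡ i ⊎ k ≡ j ⊎
        (∀ (w : List (Fin n)) → IsTotalToricExtension G ω w →
           SameCyclicClass (restrict3 i j k w) (i ∷ k ∷ j ∷ [])))
corollary5p12 G ω _ i j |I|≥3 k = mk⇔ to from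
  where
  i≢j   = proj₁ (intervalAtLeast3⇒onCommonToricChain G ω |I|≥3)
  chain = proj₂ (intervalAtLeast3⇒onCommonToricChain G ω |I|≥3)
  to : InToricInterval G ω i j k → k ≡ i ⊎ k ≡ j ⊎ AllExtensionsRestrictTo G ω i j k
  to (inj₁ (i≡j , _))                   = ⊥-elim (i≢j i≡j)
  to (inj₂ (_ , _ , inj₁ k≡i))          = inj₁ k≡i
  to (inj₂ (_ , _ , inj₂ (inj₁ k≡j)))   = inj₂ (inj₁ k≡j)
  to (inj₂ (_ , _ , inj₂ (inj₂ ikj)))   = inj₂ (inj₂ (toricChain⇒restrict3 G i j k ikj))
  from : k ≡ i ⊎ k ≡ j ⊎ AllExtensionsRestrictTo G ω i j k → InToricInterval G ω i j k
  from (inj₁ k≡i)        = inj₂ (i≢j , chain , inj₁ k≡i)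
  from (inj₂ (inj₁ k≡j)) = inj₂ (i≢j , chain , inj₂ (inj₁ k≡j))
  from (inj₂ (inj₂ restrict~ikj)) with k ≟ i | k ≟ j
  ... | yes k≡i | _       = inj₂ (i≢j , chain , inj₁ k≡i)
  ... | no _    | yes k≡j = inj₂ (i≢j , chain , inj₂ (inj₁ k≡j))
  ... | no k≢i  | no k≢j  =
    inj₂ (i≢j , chain , inj₂ (inj₂ (restrict3⇒toricChain G i j k i≢j k≢i k≢j restrict~ikj)))
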